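{- Let $G$ be a graph on $n$ vertices containing an independent set of order $m$. Then $\pi_{per}(G)\le n-m+1$.
   Context: For a graph $G$ and a vertex coloring $c:V(G)\to\mathcal{C}$, two vertex sets $V_1,V_2$ have the same coloring if $|c^{ -1}(a)\cap V_1|=|c^{ -1}(a)\cap V_2|$ for every color $a$. An anagram is a path $v_1v_2\dots v_{2k}$ ($k\ge1$) in $G$ such that $\{v_1,\dots,v_k\}$ and $\{v_{k+1},\dots,v_{2k}\}$ have the same coloring. A coloring is anagram-free if it contains no anagram, and $\pi_{per}(G)$ is the minimum number of colors in an anagram-free coloring of $G$. -}

module Defs where

open import Data.Nat using (ℕ; suc; _≥_; _∸_; _+_)
open import Data.Fin using (Fin)
open import Data.Fin.Properties using (_≟_)
open import Data.List using (List; length; filter; map; _++_)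
open import Data.List.Relation.Unary.Linked using (Linked)
open import Data.List.Relation.Unary.Unique.Propositional using (Unique)
open import Data.Product using (Σ; _×_; ∃)
open import Relation.Binary.PropositionalEquality using (_≡_; _≢_)
open import Relation.Nullary using (¬_)
open import Function.Definitions using (Injective)

record Graph (n : ℕ) : Set₁ where
  field
    Adj     : Fin n → Fin n → Set
    sym     : ∀ {u v} → Adj u v → Adj v u
    irrefl  : ∀ {v} → ¬ Adj v v
open Graph public

IsPath : ∀ {n} → Graph n → List (Fin n) → Set
IsPath G vs = Unique vs × Linked (Adj G) vs

colorCount : ∀ {n r} → (Fin n → Fin r) → Fin r → List (Fin n) → ℕ
colorCount c a vs = length (filter (λ v → c v ≟ a) vs)

SameColoring : ∀ {n r} → (Fin n → Fin r) → List (Fin n) → List (Fin n) → Set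
SameColoring c xs ys = ∀ a → colorCount c a xs ≡ colorCount c a ys

IsAnagram : ∀ {n r} → Graph n → (Fin n → Fin r) → List (Fin n) → List (Fin n) → Set
IsAnagram G c xs ys =
  IsPath G (xs ++ ys) × length xs ≥ 1 × length xs ≡ length ys × SameColoring c xs ys

AnagramFree : ∀ {n r} → Graph n → (Fin n → Fin r) → Set
AnagramFree G c = ∀ xs ys → ¬ IsAnagram G c xs ys

πper≤ : ∀ {n} → Graph n → ℕ → Set
πper≤ {n} G r = Σ (Fin n → Fin r) λ c → AnagramFree G c

HasIndependentSet : ∀ {n} → Graph n → ℕ → Set
HasIndependentSet {n} G m =
  Σ (Fin m → Fin n) λ ι → Injective _≡_ _≡_ ι × (∀ i j → ¬ Adj G (ι i) (ι j))

-- Color every vertex outside the independent set I with a color of its own and all of I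
-- with one further color; this uses at most n − m + 1 colors. Every edge has an endpoint
-- outside I, so every anagram contains a vertex u whose color occurs only at u. Since the
-- halves of the anagram are disjoint, u lies in exactly one of them, so the two halves
-- disagree on the count of u's color.
module Submission where

open import Defs hiding (sym)
open import Data.Nat using (ℕ; _∸_; _+_; suc; _≤_; s≤s)
open import Data.Nat.Properties using (+-comm; m+n≤o⇒m≤o∸n; ≤-reflexive; ≤-trans; module ≤-Reasoning)
open import Data.Fin using (Fin; zero; suc; inject≤)
open import Data.Fin.Properties using (_≟_; injective⇒≤; inject≤-injective; suc-injective)
open import Data.List using (List; []; _∷_; length; filter; map; _++_; lookup; allFin)
open import Data.List.Properties using (length-++; length-map; length-tabulate)
open import Data.List.Relation.Unary.Linked as Linked using (Linked)
open import Data.List.Relation.Unary.Any as Any using (here; there; any?)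
open import Data.List.Relation.Unary.All as All using ()
open import Data.List.Relation.Unary.AllPairs using (_∷_)
open import Data.List.Relation.Unary.Unique.Propositional using (Unique)
open import Data.List.Relation.Unary.Unique.Propositional.Properties as Unique using (allFin⁺)
open import Data.List.Membership.Propositional using (_∈_; _∉_)
open import Data.List.Membership.Propositional.Properties
  using (∈-filter⁺; ∈-filter⁻; ∈-++⁺ʳ; ∈-++⁻; ∈-lookup; ∈-allFin; ∈-map⁻)
open import Data.List.Membership.Setoid.Properties using (index-injective)
open import Data.Product using (∃; _×_; _,_; proj₂)
open import Data.Sum as Sum using (_⊎_; inj₁; inj₂)
open import Data.Empty using (⊥-elim)
open import Relation.Nullary using (¬_; ¬?; Dec; yes; no; contradiction)
open import Relation.Binary.PropositionalEquality
  using (_≡_; _≢_; refl; sym; trans; cong; subst; setoid)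
open import Function using (_∘_; id)
open import Function.Definitions using (Injective)

private
  variable
    A : Set
    n r : ℕ

UniquelyColored : (Fin n → Fin r) → Fin n → Set
UniquelyColored c u = ∀ w → c w ≡ c u → w ≡ u

VertexCover : Graph n → (Fin n → Set) → Set
VertexCover G P = ∀ {x y} → Adj G x y → P x ⊎ P y

VertexCover-mono : ∀ {G : Graph n} {P Q : Fin n → Set} →
                   (∀ {v} → P v → Q v) → VertexCover G P → VertexCover G Q
VertexCover-mono P⇒Q cover = Sum.map P⇒Q P⇒Q ∘ cover

Independent : Graph n → List (Fin n) → Set
Independent G S = ∀ {x y} → x ∈ S → y ∈ S → ¬ Adj G x y

length≢0⇒nonempty : {xs : List A} → length xs ≢ 0 → ∃ (_∈ xs)
length≢0⇒nonempty {xs = []}    ≢0 = contradiction refl ≢0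
length≢0⇒nonempty {xs = x ∷ _} _  = x , here refl

∈⇒length≢0 : {x : A} {xs : List A} → x ∈ xs → length xs ≢ 0
∈⇒length≢0 (here _)  ()
∈⇒length≢0 (there _) ()

lookup-injective : {xs : List A} → Unique xs → ∀ i j → lookup xs i ≡ lookup xs j → i ≡ j
lookup-injective (_ ∷ _)    zero    zero    _  = refl
lookup-injective (x∉ ∷ _)   zero    (suc j) eq = ⊥-elim (All.lookup x∉ (∈-lookup j) eq)
lookup-injective (x∉ ∷ _)   (suc i) zero    eq = ⊥-elim (All.lookup x∉ (∈-lookup i) (sym eq))
lookup-injective (_ ∷ xs!)  (suc i) (suc j) eq = cong suc (lookup-injective xs! i j eq)

Unique⇒length≤ : {xs : List (Fin n)} → Unique xs → length xs ≤ n
Unique⇒length≤ xs! = injective⇒≤ (lookup-injective xs! _ _)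

Unique-++⇒disjoint : {xs ys : List A} {u : A} → Unique (xs ++ ys) → u ∈ xs → u ∉ ys
Unique-++⇒disjoint {xs = _ ∷ xs} (x∉ ∷ _)  (here refl) u∈ys = All.lookup x∉ (∈-++⁺ʳ xs u∈ys) refl
Unique-++⇒disjoint               (_ ∷ xs!) (there u∈xs)     = Unique-++⇒disjoint xs! u∈xs

∷-++-∷-edge : ∀ {R : A → A → Set} x xs y ys → Linked R (x ∷ xs ++ y ∷ ys) →
              ∃ λ z → z ∈ xs ++ y ∷ ys × R x z
∷-++-∷-edge _ []      y _ linked = y , here refl , Linked.head linked
∷-++-∷-edge _ (z ∷ _) _ _ linked = z , here refl , Linked.head linked

module _ (c : Fin n → Fin r) where

  ∈⇒colorCount≢0 : ∀ {u zs} → u ∈ zs → colorCount c (c u) zs ≢ 0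
  ∈⇒colorCount≢0 {u} u∈zs = ∈⇒length≢0 (∈-filter⁺ (λ v → c v ≟ c u) u∈zs refl)

  colorCount≢0⇒∈ : ∀ {u zs} → UniquelyColored c u → colorCount c (c u) zs ≢ 0 → u ∈ zs
  colorCount≢0⇒∈ {u} {zs} unique ≢0 with length≢0⇒nonempty ≢0
  ... | w , w∈ with ∈-filter⁻ (λ v → c v ≟ c u) {xs = zs} w∈
  ...   | w∈zs , cw≡cu = subst (_∈ zs) (unique w cw≡cu) w∈zs

  SameColoring⇒∈ : ∀ {u xs ys} → UniquelyColored c u → SameColoring c xs ys → u ∈ xs → u ∈ ys
  SameColoring⇒∈ {u} unique same u∈xs =
    colorCount≢0⇒∈ unique (λ ≡0 → ∈⇒colorCount≢0 u∈xs (trans (same (c u)) ≡0))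

  uniquelyColored∉anagram : ∀ {u xs ys} → Unique (xs ++ ys) → SameColoring c xs ys →
                            UniquelyColored c u → u ∉ xs ++ ys
  uniquelyColored∉anagram {xs = xs} xs++ys! same unique u∈ with ∈-++⁻ xs u∈
  ... | inj₁ u∈xs = Unique-++⇒disjoint xs++ys! u∈xs (SameColoring⇒∈ unique same u∈xs)
  ... | inj₂ u∈ys = Unique-++⇒disjoint xs++ys! (SameColoring⇒∈ unique (sym ∘ same) u∈ys) u∈ys

  uniquelyColoredCover⇒anagramFree : (G : Graph n) → VertexCover G (UniquelyColored c) →
                                     AnagramFree G c
  uniquelyColoredCover⇒anagramFree G cover []       _        (_ , () , _)
  uniquelyColoredCover⇒anagramFree G cover (_ ∷ _)  []       (_ , _ , () , _)
  uniquelyColoredCover⇒anagramFree G cover (x ∷ xs) (y ∷ ys) ((path! , linked) , _ , _ , same)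
    with ∷-++-∷-edge x xs y ys linked
  ... | z , z∈ , xz with cover xz
  ...   | inj₁ x-unique = uniquelyColored∉anagram {xs = x ∷ xs} path! same x-unique (here refl)
  ...   | inj₂ z-unique = uniquelyColored∉anagram {xs = x ∷ xs} path! same z-unique (there z∈)

uniquelyColored-∘ : ∀ {r′} {f : Fin r → Fin r′} {c : Fin n → Fin r} {u} →
                    Injective _≡_ _≡_ f → UniquelyColored c u → UniquelyColored (f ∘ c) u
uniquelyColored-∘ f-injective unique w = unique w ∘ f-injective

separating : (J : List (Fin n)) → Fin n → Fin (suc (length J))
separating J v with any? (v ≟_) J
... | yes v∈J = suc (Any.index v∈J)
... | no  _   = zero

∈⇒uniquelyColored : ∀ {J u} → u ∈ J → UniquelyColored (separating {n} J) u
∈⇒uniquelyColored {n} {J} {u} u∈J w same with any? (u ≟_) J | any? (w ≟_) J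
... | no u∉J  | _       = contradiction u∈J u∉J
... | yes _   | no _    with () ← same
... | yes u∈J′ | yes w∈J = index-injective (setoid (Fin n)) w∈J u∈J′ (suc-injective same)

_∉?_ : (v : Fin n) (S : List (Fin n)) → Dec (v ∉ S)
v ∉? S = ¬? (any? (v ≟_) S)

complement : List (Fin n) → List (Fin n)
complement S = filter (_∉? S) (allFin _)

∉⇒∈-complement : ∀ {S v} → v ∉ S → v ∈ complement {n} S
∉⇒∈-complement v∉S = ∈-filter⁺ _ (∈-allFin _) v∉S

length-complement : {S : List (Fin n)} → Unique S → length (complement S) + length S ≤ n
length-complement {n} {S} S! = begin
  length (complement S) + length S  ≡⟨ length-++ (complement S) ⟨
  length (complement S ++ S)        ≤⟨ Unique⇒length≤ complement++S! ⟩
  n                                 ∎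
  where
  open ≤-Reasoning
  complement++S! : Unique (complement S ++ S)
  complement++S! = Unique.++⁺ (Unique.filter⁺ (_∉? S) (allFin⁺ n)) S!
                              (λ (v∈ , v∈S) → proj₂ (∈-filter⁻ (_∉? S) {xs = allFin n} v∈) v∈S)

length-complement-image : ∀ {m} {ι : Fin m → Fin n} → Injective _≡_ _≡_ ι →
                          length (complement (map ι (allFin m))) ≤ n ∸ m
length-complement-image {n} {m} {ι} ι-injective = m+n≤o⇒m≤o∸n _ (begin
  length (complement I) + m           ≡⟨ cong (length (complement I) +_) length-I ⟨
  length (complement I) + length I    ≤⟨ length-complement (Unique.map⁺ ι-injective (allFin⁺ m)) ⟩
  n                                   ∎)
  where
  open ≤-Reasoning
  I : List (Fin n)
  I = map ι (allFin m)
  length-I : length I ≡ m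
  length-I = trans (length-map ι (allFin m)) (length-tabulate id)

Independent⇒VertexCover-complement : ∀ {G : Graph n} {S} → Independent G S →
                                     VertexCover G (_∈ complement S)
Independent⇒VertexCover-complement {S = S} independent {x} {y} xy with any? (x ≟_) S | any? (y ≟_) S
... | no x∉S  | _       = inj₁ (∉⇒∈-complement x∉S)
... | yes _   | no y∉S  = inj₂ (∉⇒∈-complement y∉S)
... | yes x∈S | yes y∈S = ⊥-elim (independent x∈S y∈S xy)

image-independent : ∀ {G : Graph n} {m} (ι : Fin m → Fin n) →
                    (∀ i j → ¬ Adj G (ι i) (ι j)) → Independent G (map ι (allFin m))
image-independent _ ι-independent x∈ y∈ with ∈-map⁻ _ x∈ | ∈-map⁻ _ y∈
... | i , _ , refl | j , _ , refl = ι-independent i j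

proposition5 : (n m : ℕ) (G : Graph n) → HasIndependentSet G m → πper≤ G (n ∸ m + 1)
proposition5 n m G (ι , ι-injective , ι-independent) =
  color , uniquelyColoredCover⇒anagramFree color G color-cover
  where
  J : List (Fin n)
  J = complement (map ι (allFin m))

  fits : suc (length J) ≤ n ∸ m + 1
  fits = ≤-trans (s≤s (length-complement-image ι-injective)) (≤-reflexive (+-comm 1 (n ∸ m)))

  color : Fin n → Fin (n ∸ m + 1)
  color v = inject≤ (separating J v) fits

  J-cover : VertexCover G (_∈ J)
  J-cover = Independent⇒VertexCover-complement {G = G} (image-independent {G = G} ι ι-independent)

  color-cover : VertexCover G (UniquelyColored color)
  color-cover = VertexCover-mono {G = G}
    (λ u∈J → uniquelyColored-∘ (inject≤-injective fits fits _ _) (∈⇒uniquelyColored u∈J)) J-cover
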